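{- Let $T=(V,E)$ be a tree and let $\mathcal F$ be a family of paths in $T$ that separates $V$. Then for every edge $e\in E$ there is a path in $\mathcal F$ kissing $e$.
   Context: A path in $T$ is a sequence of distinct vertices $v_0\dots v_l$ ($l\ge0$) with consecutive ones adjacent; $V(P)$ is its vertex set. For a vertex $v$, $\mathcal F(v)$ is the set of paths in $\mathcal F$ containing $v$; $\mathcal F$ separates $V$ if $\mathcal F(u)\neq\mathcal F(v)$ for all distinct $u,v\in V$. A path $P$ kisses an edge $xy$ if $|V(P)\cap\{x,y\}|=1$. -}

module Defs where

open import Data.Nat using (ℕ; _≥_)
open import Data.Fin using (Fin)
open import Data.Maybe using (just)
open import Data.List using (List; []; _∷_; length; head; last)
open import Data.List.Membership.Propositional using (_∈_; _∉_)
open import Data.List.Relation.Unary.Unique.Propositional using (Unique)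
open import Data.List.Relation.Unary.All using (All)
open import Data.Product using (_×_; ∃-syntax)
open import Data.Sum using (_⊎_)
open import Relation.Nullary using (¬_)
open import Relation.Unary using (Pred; _≐_)
open import Relation.Binary.PropositionalEquality using (_≡_; _≢_)

record Graph (n : ℕ) : Set₁ where
  field
    Adj     : Fin n → Fin n → Set
    sym     : ∀ {x y} → Adj x y → Adj y x
    irrefl  : ∀ {x} → ¬ Adj x x
open Graph public

data Walk {n : ℕ} (G : Graph n) : List (Fin n) → Set where
  single : ∀ v → Walk G (v ∷ [])
  step   : ∀ {u v vs} → Adj G u v → Walk G (v ∷ vs) → Walk G (u ∷ v ∷ vs)

-- A path v0 … vl (l ≥ 0): distinct vertices, consecutive ones adjacent.
-- A path is represented by its vertex sequence; V(P) is membership in it.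
IsPath : {n : ℕ} → Graph n → List (Fin n) → Set
IsPath G P = Walk G P × Unique P

PathBetween : {n : ℕ} → Graph n → Fin n → Fin n → List (Fin n) → Set
PathBetween G u v P = IsPath G P × head P ≡ just u × last P ≡ just v

Connected : {n : ℕ} → Graph n → Set
Connected G = ∀ u v → ∃[ P ] PathBetween G u v P

IsCycle : {n : ℕ} → Graph n → List (Fin n) → Set
IsCycle G C = IsPath G C × length C ≥ 3
            × ∃[ a ] ∃[ b ] (head C ≡ just a × last C ≡ just b × Adj G b a)

Acyclic : {n : ℕ} → Graph n → Set
Acyclic G = ∀ C → ¬ IsCycle G C

IsTree : {n : ℕ} → Graph n → Set
IsTree G = Connected G × Acyclic G

IsPathFamily : {n : ℕ} → Graph n → List (List (Fin n)) → Set
IsPathFamily G F = All (IsPath G) F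

FamAt : {n : ℕ} → List (List (Fin n)) → Fin n → Pred (List (Fin n)) _
FamAt F v P = P ∈ F × v ∈ P

Separates : {n : ℕ} → List (List (Fin n)) → Set
Separates {n} F = ∀ (u v : Fin n) → u ≢ v → ¬ (FamAt F u ≐ FamAt F v)

Kisses : {n : ℕ} → List (Fin n) → Fin n → Fin n → Set
Kisses P x y = (x ∈ P × y ∉ P) ⊎ (y ∈ P × x ∉ P)

{-# OPTIONS --safe #-}
module Submission where

-- If no path of F kisses the edge xy, every path of F contains both x and y
-- or neither, so F(x) = F(y); as T is loopless, x ≠ y, contradicting
-- separation.

open import Defs
open import Data.Nat using (ℕ)
open import Data.Fin using (Fin)
open import Data.Fin.Properties using (_≟_)
open import Data.List using (List)
open import Data.List.Membership.Propositional using (_∈_; find; lose)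
import Data.List.Membership.DecPropositional as DecMembership
open import Data.List.Relation.Unary.Any using (any?)
open import Data.Product using (_×_; ∃-syntax; _,_)
open import Data.Sum using (inj₁; inj₂; swap)
open import Function using (_∘_)
open import Relation.Nullary using (Dec; yes; no; ¬_; contradiction)
open import Relation.Nullary.Decidable using (_×-dec_; _⊎-dec_; ¬?)
open import Relation.Unary using (_≐_)
open import Relation.Binary.PropositionalEquality using (_≢_; refl)

private
  variable
    n : ℕ
    x y : Fin n
    P : List (Fin n)
    F : List (List (Fin n))

_∈?_ : (v : Fin n) (P : List (Fin n)) → Dec (v ∈ P)
_∈?_ {n} = DecMembership._∈?_ (_≟_ {n})

kisses? : (P : List (Fin n)) (x y : Fin n) → Dec (Kisses P x y)
kisses? P x y = ((x ∈? P) ×-dec ¬? (y ∈? P)) ⊎-dec ((y ∈? P) ×-dec ¬? (x ∈? P))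

kisses-sym : Kisses P x y → Kisses P y x
kisses-sym = swap

¬kisses⇒∈ : ¬ Kisses P x y → x ∈ P → y ∈ P
¬kisses⇒∈ {P = P} {y = y} ¬k x∈P with y ∈? P
... | yes y∈P = y∈P
... | no  y∉P = contradiction (inj₁ (x∈P , y∉P)) ¬k

¬kisses⇒FamAt≐ : (∀ {P} → P ∈ F → ¬ Kisses P x y) → FamAt F x ≐ FamAt F y
¬kisses⇒FamAt≐ ¬k =
    (λ (P∈F , x∈P) → P∈F , ¬kisses⇒∈ (¬k P∈F) x∈P)
  , (λ (P∈F , y∈P) → P∈F , ¬kisses⇒∈ (¬k P∈F ∘ kisses-sym) y∈P)

adj⇒≢ : (G : Graph n) → Adj G x y → x ≢ y
adj⇒≢ G xy refl = irrefl G xy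

lemma6p1 : ∀ {n} (T : Graph n) → IsTree T
         → (F : List (List (Fin n))) → IsPathFamily T F → Separates F
         → ∀ x y → Adj T x y → ∃[ P ] (P ∈ F × Kisses P x y)
lemma6p1 T _ F _ sep x y xy with any? (λ P → kisses? P x y) F
... | yes some-kisses = find some-kisses
... | no  none-kisses =
  contradiction (¬kisses⇒FamAt≐ (λ P∈F → none-kisses ∘ lose P∈F))
                (sep x y (adj⇒≢ T xy))
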